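{- For each prime $q>2$ there is a cyclic tiling of $\mathbb{Z}^{q-1}$ by translates of the semi-cross $V_{q-1}=\{\mathbf{0},\mathbf{e}_1,\dots,\mathbf{e}_{q-1}\}$; that is, there is $\mathcal{L}\subset\mathbb{Z}^{q-1}$ such that $\{V_{q-1}+l: l\in\mathcal{L}\}$ is a tiling of $\mathbb{Z}^{q-1}$ and, for every $(a_1,\dots,a_{q-1})\in\mathcal{L}$, all its cyclic shifts (e.g. $(a_2,a_3,\dots,a_{q-1},a_1)$ and its iterates) also lie in $\mathcal{L}$.
   Context: A tiling of $\mathbb{Z}^{m}$ by translates of $V$ is a family $\{V+l: l\in\mathcal{L}\}$ such that every $x\in\mathbb{Z}^m$ can be written uniquely as $x=v+l$ with $v\in V$, $l\in\mathcal{L}$. $\mathbf{e}_i$ is the $i$-th standard basis vector. -}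

module Defs where

open import Data.Nat using (ℕ; zero; suc)
open import Data.Nat.Primality using (Prime)
open import Data.Fin using (Fin; toℕ; fromℕ<)
open import Data.Nat.DivMod using (_%_; m%n<n)
open import Data.Integer as ℤ using (ℤ; +_)
open import Data.Maybe using (Maybe; just; nothing)
open import Data.Product using (Σ; _×_; _,_; ∃)
open import Relation.Binary.PropositionalEquality using (_≡_)
open import Relation.Nullary using (Dec; yes; no)
open import Data.Fin using (_≟_)

Point : ℕ → Set
Point n = Fin n → ℤ

_≋_ : ∀ {n} → Point n → Point n → Set
x ≋ y = ∀ i → x i ≡ y i

_⊕_ : ∀ {n} → Point n → Point n → Point n
(x ⊕ y) i = x i ℤ.+ y i

e : ∀ {n} → Fin n → Point n
e j i with i ≟ j
... | yes _ = + 1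
... | no _  = + 0

-- the semi-cross V_n = {0, e_1, ..., e_n}: nothing ↦ 0, just j ↦ e_j
semiCross : ∀ {n} → Maybe (Fin n) → Point n
semiCross nothing  _ = + 0
semiCross (just j) = e j

-- a family of translates {V + l : l ∈ L} (L a subset of ℤ^n given as a predicate)
-- tiles ℤ^n: every x is uniquely v + l with v ∈ V, l ∈ L
IsTiling : ∀ {n} {I : Set} → (I → Point n) → (Point n → Set) → Set
IsTiling {n} {I} V L =
  (x : Point n) →
    Σ I (λ v → Σ (Point n) (λ l → L l × (x ≋ (V v ⊕ l))))
    × (∀ v v′ l l′ → L l → L l′ → x ≋ (V v ⊕ l) → x ≋ (V v′ ⊕ l′) →
         v ≡ v′ × l ≋ l′)

-- cyclic shift (a_1,...,a_n) ↦ (a_2,...,a_n,a_1): new i-th coordinate is a_{i+1 mod n}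
shift : ∀ {n} → Point n → Point n
shift {suc n} a i = a (fromℕ< (m%n<n (suc (toℕ i)) (suc n)))

shiftIter : ∀ {n} → ℕ → Point n → Point n
shiftIter zero    a = a
shiftIter (suc k) a = shift (shiftIter k a)

CyclicallyClosed : ∀ {n} → (Point n → Set) → Set
CyclicallyClosed {n} L = ∀ (k : ℕ) (a : Point n) → L a → L (shiftIter k a)

-- With g a primitive root modulo the prime p, take L = {x ∈ ℤ^(p-1) : Σᵢ gⁱ xᵢ ≡ 0 (mod p)}.
-- The vectors 0, e₀, …, e_(p-2) of the semi-cross have weights 0, g⁰, …, g^(p-2), a complete
-- residue system mod p, so every x lies in exactly one translate of V by L. A cyclic shift
-- multiplies the weight by g⁻¹, the wrapped-around coordinate picking up g^(p-1) ≡ 1, so L is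
-- closed under cyclic shifts.
-- A primitive root exists: if g has maximal order d and some unit u had uᵈ ≢ 1, the order of u
-- would not divide d, and combining prime-power parts of the two orders would give a larger
-- order. So all p - 1 units are roots of xᵈ - 1, and Lagrange's bound on roots gives d ≥ p - 1.

module Submission where

open import Defs
open import Data.Nat as ℕ using (ℕ; zero; suc; _≤_; _<_; _∸_; _>_)
import Data.Nat.Properties as ℕP
open import Data.Nat.Divisibility using (_∣_; _∤_; divides; _∣?_; ∣-antisym; ∣-trans; >⇒∤; n∣m*n; m∣m*n; ∣1⇒≡1; 1∣_; *-cancelˡ-∣; *-monoˡ-∣; m%n≡0⇒n∣m)
open import Data.Nat.DivMod using (_%_; _/_; m≡m%n+[m/n]*n; m%n<n; m<n⇒m%n≡m; n%n≡0)
open import Data.Nat.Coprimality using (Coprime; coprime-divisor)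
import Data.Nat.Coprimality as Coprime
open import Data.Nat.Primality using (Prime; euclidsLemma; prime⇒irreducible; prime⇒nonTrivial)
open import Data.Nat.Primality.Factorisation using (factorise)
open import Data.Nat.Induction using (<-rec)
import Data.Nat.Tactic.RingSolver as ℕSolver
open import Data.Nat.ListAction using (product)
open import Data.Integer using (ℤ; +_; 0ℤ; 1ℤ; -1ℤ; _+_; _*_; _-_; -_; _^_; ∣_∣; _⊖_)
import Data.Integer.Properties as ℤP
import Data.Integer.Divisibility.Signed as ℤ∣
open import Data.Integer.DivMod using (_%ℕ_; _/ℕ_; n%ℕd<d; a≡a%ℕn+[a/ℕn]*n)
open import Data.Integer.Tactic.RingSolver using (solve-∀)
open import Algebra.Properties.Semiring.Sum ℤP.+-*-semiring using (sum; sum-syntax; sum-cong-≗; sum-remove; sum-replicate-zero; ∑-distrib-+; *-distribˡ-sum; sum-init-last)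
open import Algebra.Properties.AbelianGroup ℤP.+-0-abelianGroup using () renaming (∙-cancelˡ to +-cancelˡ)
open import Data.Fin as Fin using (Fin; toℕ; fromℕ<; fromℕ; inject₁; inject≤; punchIn; punchOut; _≟_)
import Data.Fin.Properties as FinP
open import Data.List using ([]; _∷_)
import Data.List.Relation.Unary.All as All
open import Data.Vec using (Vec; []; _∷_; last)
open import Data.Maybe using (Maybe; just; nothing)
open import Data.Product using (Σ; ∃; ∃₂; _×_; _,_; proj₁; proj₂)
open import Data.Sum using (_⊎_; inj₁; inj₂)
open import Function using (_∘_)
open import Function.Definitions using (Injective)
open import Level using (0ℓ)
open import Relation.Binary.Core using (Rel)
open import Relation.Binary.Definitions using (Reflexive; Symmetric; Transitive; Decidable)
open import Relation.Binary.Structures using (IsEquivalence)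
open import Relation.Binary.Bundles using (Setoid)
import Relation.Binary.Reasoning.Setoid as SetoidReasoning
open import Relation.Binary.PropositionalEquality using (_≡_; _≢_; refl; sym; trans; cong; cong₂; subst; module ≡-Reasoning)
open import Relation.Nullary using (¬_; Dec; yes; no; contradiction)
import Relation.Nullary.Decidable as Dec
open import Relation.Nullary.Decidable using (_×-dec_)

-- Elementary number theory

∣∧<⇒≡0 : ∀ {m x} → m ∣ x → x < m → x ≡ 0
∣∧<⇒≡0 {x = zero}  _   _   = refl
∣∧<⇒≡0 {x = suc x} m∣x x<m = contradiction m∣x (>⇒∤ x<m)

leastWitness : ∀ {p} {P : ℕ → Set p} → (∀ k → Dec (P k)) → ∀ n → P n →
               ∃ λ d → d ≤ n × P d × (∀ {j} → j < d → ¬ P j)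
leastWitness {P = P} P? = <-rec _ least
  where
  least : ∀ n → (∀ {k} → k < n → P k → ∃ λ d → d ≤ k × P d × (∀ {j} → j < d → ¬ P j)) →
          P n → ∃ λ d → d ≤ n × P d × (∀ {j} → j < d → ¬ P j)
  least n rec Pn with FinP.any? (λ (i : Fin n) → P? (toℕ i))
  ... | yes (i , Pi) with d , d≤i , Pd , below ← rec (FinP.toℕ<n i) Pi
    = d , ℕP.≤-trans d≤i (ℕP.<⇒≤ (FinP.toℕ<n i)) , Pd , below
  ... | no none = n , ℕP.≤-refl , Pn , λ j<n Pj → none (fromℕ< j<n , subst P (sym (FinP.toℕ-fromℕ< j<n)) Pj)

prime-factor : ∀ {s} → 2 ≤ s → ∃₂ λ ℓ u → Prime ℓ × s ≡ ℓ ℕ.* u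
prime-factor {s@(suc _)} 2≤s with factorise s
... | record { factors = [] ; isFactorisation = s≡1 } = contradiction (sym s≡1) (ℕP.<⇒≢ 2≤s)
... | record { factors = ℓ ∷ ℓs ; isFactorisation = s≡ℓ*u ; factorsPrime = ℓ-prime All.∷ _ } =
  ℓ , product ℓs , ℓ-prime , s≡ℓ*u

prime-power-split : ∀ {ℓ u} → Prime ℓ → 0 < u → ∃₂ λ a r → u ≡ ℓ ℕ.^ a ℕ.* r × ℓ ∤ r
prime-power-split {ℓ} ℓ-prime = <-rec _ split _
  where
  split : ∀ u → (∀ {v} → v < u → 0 < v → ∃₂ λ a r → v ≡ ℓ ℕ.^ a ℕ.* r × ℓ ∤ r) →
          0 < u → ∃₂ λ a r → u ≡ ℓ ℕ.^ a ℕ.* r × ℓ ∤ r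
  split u rec 0<u with ℓ ∣? u
  ... | no ℓ∤u = 0 , u , sym (ℕP.+-identityʳ u) , ℓ∤u
  ... | yes (divides v refl) = raise (rec v<u 0<v)
    where
    instance _ = ℕ.>-nonZero 0<u
    0<v : 0 < v
    0<v = ℕ.>-nonZero⁻¹ v {{ℕP.m*n≢0⇒m≢0 v}}
    v<u : v < v ℕ.* ℓ
    v<u = ℕP.m<m*n v ℓ {{ℕ.>-nonZero 0<v}} (ℕ.nonTrivial⇒n>1 ℓ {{prime⇒nonTrivial ℓ-prime}})
    reassoc : ∀ L r ℓ → L ℕ.* r ℕ.* ℓ ≡ ℓ ℕ.* L ℕ.* r
    reassoc = ℕSolver.solve-∀
    raise : (∃₂ λ a r → v ≡ ℓ ℕ.^ a ℕ.* r × ℓ ∤ r) → ∃₂ λ a r → v ℕ.* ℓ ≡ ℓ ℕ.^ a ℕ.* r × ℓ ∤ r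
    raise (a , r , v≡ℓᵃr , ℓ∤r) = suc a , r , trans (cong (λ x → x ℕ.* ℓ) v≡ℓᵃr) (reassoc (ℓ ℕ.^ a) r ℓ) , ℓ∤r

prime∤⇒coprime : ∀ {ℓ x} → Prime ℓ → ℓ ∤ x → Coprime ℓ x
prime∤⇒coprime ℓ-prime ℓ∤x (d∣ℓ , d∣x) with prime⇒irreducible ℓ-prime d∣ℓ
... | inj₁ d≡1 = d≡1
... | inj₂ refl = contradiction d∣x ℓ∤x

coprime-*ˡ : ∀ {a b x} → Coprime a x → Coprime b x → Coprime (a ℕ.* b) x
coprime-*ˡ {a} {x = x} a⊥x b⊥x {i} (i∣ab , i∣x) = b⊥x (coprime-divisor i⊥a i∣ab , i∣x)
  where i⊥a : Coprime i a
        i⊥a (j∣i , j∣a) = a⊥x (j∣a , ∣-trans j∣i i∣x)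

prime∤⇒coprime-^ : ∀ {ℓ x} → Prime ℓ → ℓ ∤ x → ∀ a → Coprime (ℓ ℕ.^ a) x
prime∤⇒coprime-^ _       _   zero    (d∣1 , _) = ∣1⇒≡1 d∣1
prime∤⇒coprime-^ ℓ-prime ℓ∤x (suc a) = coprime-*ˡ (prime∤⇒coprime ℓ-prime ℓ∤x) (prime∤⇒coprime-^ ℓ-prime ℓ∤x a)

coprime⇒*∣ : ∀ {r s t} → Coprime r s → r ∣ t → s ∣ t → r ℕ.* s ∣ t
coprime⇒*∣ {r} {s} r⊥s (divides c refl) s∣cr
  with divides e refl ← coprime-divisor (Coprime.sym r⊥s) (subst (s ∣_) (ℕP.*-comm c r) s∣cr)
  = divides e (reassoc e s r)
  where reassoc : ∀ e s r → e ℕ.* s ℕ.* r ≡ e ℕ.* (r ℕ.* s)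
        reassoc = ℕSolver.solve-∀

∤⇒1< : ∀ {s d} → 0 < s → s ∤ d → 1 < s
∤⇒1< {suc zero}    _ s∤d = contradiction (1∣ _) s∤d
∤⇒1< {suc (suc _)} _ _   = ℕ.s≤s (ℕ.s≤s ℕ.z≤n)

module Congruence (m : ℕ) where

  infix 4 _≈_ _≉_ _≈?_

  -- A record rather than an abbreviation of + m ∣ a - b, so that a and b stay inferable.
  record _≈_ (a b : ℤ) : Set where
    constructor mk≈
    field m∣a-b : + m ℤ∣.∣ a - b

  _≉_ : Rel ℤ 0ℓ
  a ≉ b = ¬ a ≈ b

  private
    m∣⇒≈ : ∀ {x a b} → x ≡ a - b → + m ℤ∣.∣ x → a ≈ b
    m∣⇒≈ eq m∣x = mk≈ (subst (+ m ℤ∣.∣_) eq m∣x)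

  ≡⇒≈ : ∀ {a b} → a ≡ b → a ≈ b
  ≡⇒≈ {a} refl = mk≈ (ℤ∣.divides 0ℤ (a-a≡0*m a (+ m)))
    where a-a≡0*m : ∀ a m → a - a ≡ 0ℤ * m
          a-a≡0*m = solve-∀

  ≈-refl : Reflexive _≈_
  ≈-refl = ≡⇒≈ refl

  ≈-sym : Symmetric _≈_
  ≈-sym {a} {b} (mk≈ a≈b) = m∣⇒≈ (-[a-b]≡b-a a b) (ℤ∣.∣m⇒∣-m a≈b)
    where -[a-b]≡b-a : ∀ a b → - (a - b) ≡ b - a
          -[a-b]≡b-a = solve-∀

  ≈-trans : Transitive _≈_
  ≈-trans {a} {b} {c} (mk≈ a≈b) (mk≈ b≈c) = m∣⇒≈ (telescope a b c) (ℤ∣.∣m∣n⇒∣m+n a≈b b≈c)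
    where telescope : ∀ a b c → (a - b) + (b - c) ≡ a - c
          telescope = solve-∀

  ≈-isEquivalence : IsEquivalence _≈_
  ≈-isEquivalence = record { refl = ≈-refl ; sym = ≈-sym ; trans = ≈-trans }

  ≈-setoid : Setoid 0ℓ 0ℓ
  ≈-setoid = record { isEquivalence = ≈-isEquivalence }

  module ≈-Reasoning = SetoidReasoning ≈-setoid

  _≈?_ : Decidable _≈_
  a ≈? b = Dec.map′ mk≈ _≈_.m∣a-b (+ m ℤ∣.∣? (a - b))

  +-cong : ∀ {a b c d} → a ≈ b → c ≈ d → a + c ≈ b + d
  +-cong {a} {b} {c} {d} (mk≈ a≈b) (mk≈ c≈d) = m∣⇒≈ (regroup a b c d) (ℤ∣.∣m∣n⇒∣m+n a≈b c≈d)
    where regroup : ∀ a b c d → (a - b) + (c - d) ≡ (a + c) - (b + d)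
          regroup = solve-∀

  +-congˡ : ∀ c {a b} → a ≈ b → c + a ≈ c + b
  +-congˡ c = +-cong (≈-refl {c})

  -‿cong : ∀ {a b} → a ≈ b → - a ≈ - b
  -‿cong {a} {b} (mk≈ a≈b) = m∣⇒≈ (regroup a b) (ℤ∣.∣m⇒∣-m a≈b)
    where regroup : ∀ a b → - (a - b) ≡ - a - - b
          regroup = solve-∀

  *-cong : ∀ {a b c d} → a ≈ b → c ≈ d → a * c ≈ b * d
  *-cong {a} {b} {c} {d} (mk≈ a≈b) (mk≈ c≈d) =
    m∣⇒≈ (regroup a b c d) (ℤ∣.∣m∣n⇒∣m+n (ℤ∣.∣n⇒∣m*n a c≈d) (ℤ∣.∣m⇒∣m*n d a≈b))
    where regroup : ∀ a b c d → a * (c - d) + (a - b) * d ≡ a * c - b * d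
          regroup = solve-∀

  *-congˡ : ∀ c {a b} → a ≈ b → c * a ≈ c * b
  *-congˡ c = *-cong (≈-refl {c})

  *-congʳ : ∀ c {a b} → a ≈ b → a * c ≈ b * c
  *-congʳ c a≈b = *-cong a≈b (≈-refl {c})

  ^-congˡ : ∀ {a b} k → a ≈ b → a ^ k ≈ b ^ k
  ^-congˡ zero    a≈b = ≈-refl
  ^-congˡ (suc k) a≈b = *-cong a≈b (^-congˡ k a≈b)

  +-cancelˡ-≈ : ∀ c {a b} → c + a ≈ c + b → a ≈ b
  +-cancelˡ-≈ c {a} {b} (mk≈ m∣x) = m∣⇒≈ (cancel c a b) m∣x
    where cancel : ∀ c a b → (c + a) - (c + b) ≡ a - b
          cancel = solve-∀

  ≈⇒-≈0 : ∀ {a b} → a ≈ b → a - b ≈ 0ℤ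
  ≈⇒-≈0 {a} {b} (mk≈ m∣x) = m∣⇒≈ (sym (ℤP.+-identityʳ (a - b))) m∣x

  -≈0⇒≈ : ∀ {a b} → a - b ≈ 0ℤ → a ≈ b
  -≈0⇒≈ {a} {b} (mk≈ m∣x) = m∣⇒≈ (ℤP.+-identityʳ (a - b)) m∣x

  ≈0⇒∣∣∣ : ∀ {a} → a ≈ 0ℤ → m ∣ ∣ a ∣
  ≈0⇒∣∣∣ {a} (mk≈ a≈0) = subst (λ x → m ∣ ∣ x ∣) (ℤP.+-identityʳ a) (ℤ∣.∣⇒∣ᵤ a≈0)

  ∣∣∣⇒≈0 : ∀ {a} → m ∣ ∣ a ∣ → a ≈ 0ℤ
  ∣∣∣⇒≈0 {a} m∣a = m∣⇒≈ (sym (ℤP.+-identityʳ a)) (ℤ∣.∣ᵤ⇒∣ m∣a)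

  +≈+⇒≡ : ∀ {i j} → i < m → j < m → + i ≈ + j → i ≡ j
  +≈+⇒≡ {i} {j} i<m j<m i≈j = ℤP.+-injective (ℤP.i-j≡0⇒i≡j (+ i) (+ j) (trans (ℤP.[+m]-[+n]≡m⊖n i j) (ℤP.∣i∣≡0⇒i≡0 ∣i⊖j∣≡0)))
    where
    ∣i⊖j∣<m : ∣ i ⊖ j ∣ < m
    ∣i⊖j∣<m = ℕP.≤-<-trans (ℤP.∣m⊝n∣≤m⊔n i j) (ℕP.⊔-lub i<m j<m)
    ∣i⊖j∣≡0 : ∣ i ⊖ j ∣ ≡ 0
    ∣i⊖j∣≡0 = ∣∧<⇒≡0 (subst (m ∣_) (cong ∣_∣ (ℤP.[+m]-[+n]≡m⊖n i j)) (ℤ∣.∣⇒∣ᵤ (_≈_.m∣a-b i≈j))) ∣i⊖j∣<m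

module Residues (m′ : ℕ) where

  open Congruence (suc m′)

  residue : ℤ → Fin (suc m′)
  residue a = fromℕ< (n%ℕd<d a (suc m′))

  ≈-residue : ∀ a → a ≈ + toℕ (residue a)
  ≈-residue a = mk≈ (ℤ∣.divides q (begin
    a - + toℕ (residue a)     ≡⟨ cong (λ r → a - + r) (FinP.toℕ-fromℕ< (n%ℕd<d a (suc m′))) ⟩
    a - + r                   ≡⟨ cong (_- + r) (a≡a%ℕn+[a/ℕn]*n a (suc m′)) ⟩
    + r + q * + suc m′ - + r  ≡⟨ cancel (+ r) (q * + suc m′) ⟩
    q * + suc m′              ∎))
    where
    open ≡-Reasoning
    r = a %ℕ suc m′
    q = a /ℕ suc m′
    cancel : ∀ r s → r + s - r ≡ s
    cancel = solve-∀

  residue-injective : ∀ {a b} → residue a ≡ residue b → a ≈ b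
  residue-injective {a} {b} eq = ≈-trans (≈-residue a) (≈-trans (≡⇒≈ (cong (λ i → + toℕ i) eq)) (≈-sym (≈-residue b)))

  injective⇒complete : (f : Fin (suc m′) → ℤ) → Injective _≡_ _≈_ f → ∀ a → ∃ λ i → f i ≈ a
  injective⇒complete f f-inj a with FinP.pigeonhole (ℕP.n<1+n (suc m′)) residues
    where
    residues : Fin (suc (suc m′)) → Fin (suc m′)
    residues Fin.zero    = residue a
    residues (Fin.suc i) = residue (f i)
  ... | Fin.zero  , Fin.suc j , _   , eq = j , ≈-sym (residue-injective eq)
  ... | Fin.suc i , Fin.suc j , i<j , eq = contradiction (cong Fin.suc (f-inj (residue-injective eq))) (FinP.<⇒≢ i<j)

  0≢residue : ∀ {a} → a ≉ 0ℤ → Fin.zero ≢ residue a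
  0≢residue a≉0 = a≉0 ∘ ≈-sym ∘ residue-injective

  nonzeroResidue : ∀ a → a ≉ 0ℤ → Fin m′
  nonzeroResidue a a≉0 = punchOut (0≢residue a≉0)

  nonzeroResidue-injective : ∀ {a b} (a≉0 : a ≉ 0ℤ) (b≉0 : b ≉ 0ℤ) →
                             nonzeroResidue a a≉0 ≡ nonzeroResidue b b≉0 → a ≈ b
  nonzeroResidue-injective a≉0 b≉0 eq = residue-injective (FinP.punchOut-injective (0≢residue a≉0) (0≢residue b≉0) eq)

  nonzero-collision : (f : Fin (suc m′) → ℤ) → (∀ i → f i ≉ 0ℤ) → ∃₂ λ i j → i Fin.< j × f i ≈ f j
  nonzero-collision f f≉0 = collide (FinP.pigeonhole (ℕP.n<1+n m′) classes)
    where
    classes : Fin (suc m′) → Fin m′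
    classes i = nonzeroResidue (f i) (f≉0 i)
    collide : (∃₂ λ i j → i Fin.< j × classes i ≡ classes j) → ∃₂ λ i j → i Fin.< j × f i ≈ f j
    collide (i , j , i<j , eq) = i , j , i<j , nonzeroResidue-injective (f≉0 i) (f≉0 j) eq

^-distribʳ-* : ∀ a b t → (a * b) ^ t ≡ a ^ t * b ^ t
^-distribʳ-* a b zero    = refl
^-distribʳ-* a b (suc t) = trans (cong (a * b *_) (^-distribʳ-* a b t)) (interchange a b (a ^ t) (b ^ t))
  where interchange : ∀ a b x y → a * b * (x * y) ≡ a * x * (b * y)
        interchange = solve-∀

module Order (m : ℕ) where

  open Congruence m

  record HasOrder (a : ℤ) (d : ℕ) : Set where
    field
      positive : 0 < d
      ^d≈1     : a ^ d ≈ 1ℤ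
      ^≈1⇒∣    : ∀ {t} → a ^ t ≈ 1ℤ → d ∣ t

  open HasOrder public

  ^-multiple≈1 : ∀ {a d} → a ^ d ≈ 1ℤ → ∀ c → a ^ (c ℕ.* d) ≈ 1ℤ
  ^-multiple≈1 {a} {d} a^d≈1 c = begin
    a ^ (c ℕ.* d)   ≡⟨ cong (a ^_) (ℕP.*-comm c d) ⟩
    a ^ (d ℕ.* c)   ≡⟨ ℤP.^-*-assoc a d c ⟨
    (a ^ d) ^ c     ≈⟨ ^-congˡ c a^d≈1 ⟩
    1ℤ ^ c          ≡⟨ ℤP.^-zeroˡ c ⟩
    1ℤ              ∎
    where open ≈-Reasoning

  ∣⇒^≈1 : ∀ {a d t} → HasOrder a d → d ∣ t → a ^ t ≈ 1ℤ
  ∣⇒^≈1 o (divides c refl) = ^-multiple≈1 (^d≈1 o) c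

  least⇒HasOrder : ∀ {a d} → 0 < d → a ^ d ≈ 1ℤ → (∀ {j} → 0 < j → j < d → a ^ j ≉ 1ℤ) → HasOrder a d
  least⇒HasOrder {a} {d} 0<d a^d≈1 least = record { positive = 0<d ; ^d≈1 = a^d≈1 ; ^≈1⇒∣ = ∣t }
    where
    instance _ = ℕ.>-nonZero 0<d
    ∣t : ∀ {t} → a ^ t ≈ 1ℤ → d ∣ t
    ∣t {t} a^t≈1 with t % d in t%d≡r
    ... | zero  = m%n≡0⇒n∣m t d t%d≡r
    ... | suc r = contradiction a^[t%d]≈1 (least ℕ.z<s (subst (_< d) t%d≡r (m%n<n t d)))
      where
      a^[t%d]≈1 : a ^ suc r ≈ 1ℤ
      a^[t%d]≈1 = begin
        a ^ suc r                       ≡⟨ ℤP.*-identityʳ _ ⟨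
        a ^ suc r * 1ℤ                  ≈⟨ *-congˡ (a ^ suc r) (^-multiple≈1 {a} {d} a^d≈1 (t / d)) ⟨
        a ^ suc r * a ^ (t / d ℕ.* d)   ≡⟨ ℤP.^-distribˡ-+-* a (suc r) (t / d ℕ.* d) ⟨
        a ^ (suc r ℕ.+ t / d ℕ.* d)     ≡⟨ cong (λ x → a ^ (x ℕ.+ t / d ℕ.* d)) t%d≡r ⟨
        a ^ (t % d ℕ.+ t / d ℕ.* d)     ≡⟨ cong (a ^_) (m≡m%n+[m/n]*n t d) ⟨
        a ^ t                           ≈⟨ a^t≈1 ⟩
        1ℤ                              ∎
        where open ≈-Reasoning

  HasOrder-1 : HasOrder 1ℤ 1
  HasOrder-1 = least⇒HasOrder ℕ.z<s ≈-refl λ { ℕ.z<s (ℕ.s≤s ()) }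

  HasOrder-unique : ∀ {a d e} → HasOrder a d → HasOrder a e → d ≡ e
  HasOrder-unique a-order e-order = ∣-antisym (^≈1⇒∣ a-order (^d≈1 e-order)) (^≈1⇒∣ e-order (^d≈1 a-order))

  HasOrder-^ : ∀ {a} r {s} → HasOrder a (r ℕ.* s) → HasOrder (a ^ r) s
  HasOrder-^ {a} r {s} o = record
    { positive = ℕ.>-nonZero⁻¹ s {{ℕP.m*n≢0⇒n≢0 r}}
    ; ^d≈1     = ≈-trans (≡⇒≈ (ℤP.^-*-assoc a r s)) (^d≈1 o)
    ; ^≈1⇒∣    = λ {t} a^rt≈1 → *-cancelˡ-∣ r (^≈1⇒∣ o (≈-trans (≡⇒≈ (sym (ℤP.^-*-assoc a r t))) a^rt≈1))
    }
    where instance _ = ℕ.>-nonZero (positive o)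
                   _ = ℕP.m*n≢0⇒m≢0 r

  ^≈1-cancelʳ : ∀ a b t → (a * b) ^ t ≈ 1ℤ → b ^ t ≈ 1ℤ → a ^ t ≈ 1ℤ
  ^≈1-cancelʳ a b t ab^t≈1 b^t≈1 = begin
    a ^ t           ≡⟨ ℤP.*-identityʳ (a ^ t) ⟨
    a ^ t * 1ℤ      ≈⟨ *-congˡ (a ^ t) b^t≈1 ⟨
    a ^ t * b ^ t   ≡⟨ ^-distribʳ-* a b t ⟨
    (a * b) ^ t     ≈⟨ ab^t≈1 ⟩
    1ℤ              ∎
    where open ≈-Reasoning

  HasOrder-* : ∀ {a b r s} → HasOrder a r → HasOrder b s → Coprime r s → HasOrder (a * b) (r ℕ.* s)
  HasOrder-* {a} {b} {r} {s} a-order b-order r⊥s = record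
    { positive = ℕ.>-nonZero⁻¹ (r ℕ.* s) {{ℕP.m*n≢0 r s}}
    ; ^d≈1     = ≈-trans (≡⇒≈ (^-distribʳ-* a b (r ℕ.* s))) (*-cong (∣⇒^≈1 a-order (m∣m*n s)) (∣⇒^≈1 b-order (n∣m*n r)))
    ; ^≈1⇒∣    = λ ab^t≈1 → coprime⇒*∣ r⊥s (r∣ ab^t≈1) (s∣ ab^t≈1)
    }
    where
    instance _ = ℕ.>-nonZero (positive a-order)
             _ = ℕ.>-nonZero (positive b-order)
    r∣ : ∀ {t} → (a * b) ^ t ≈ 1ℤ → r ∣ t
    r∣ {t} ab^t≈1 = coprime-divisor r⊥s (^≈1⇒∣ a-order (^≈1-cancelʳ a b (s ℕ.* t) (^-multiple≈1 {a * b} {t} ab^t≈1 s) (∣⇒^≈1 b-order (m∣m*n t))))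
    s∣ : ∀ {t} → (a * b) ^ t ≈ 1ℤ → s ∣ t
    s∣ {t} ab^t≈1 = coprime-divisor (Coprime.sym r⊥s)
      (^≈1⇒∣ b-order (^≈1-cancelʳ b a (r ℕ.* t) (^-multiple≈1 {b * a} {t} ba^t≈1 r) (∣⇒^≈1 a-order (m∣m*n t))))
      where ba^t≈1 = subst (λ x → x ^ t ≈ 1ℤ) (ℤP.*-comm a b) ab^t≈1

  -- h ^ r has order ℓ ^ (1 + a) and g ^ (ℓ ^ a) has order r t, and these are coprime.
  HasOrder-prime-step : ∀ {ℓ a r t g h} → Prime ℓ → ℓ ∤ r → ℓ ∤ t →
                        HasOrder g (t ℕ.* (ℓ ℕ.^ a ℕ.* r)) → HasOrder h (ℓ ℕ.* (ℓ ℕ.^ a ℕ.* r)) →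
                        HasOrder (h ^ r * g ^ (ℓ ℕ.^ a)) (ℓ ℕ.* (t ℕ.* (ℓ ℕ.^ a ℕ.* r)))
  HasOrder-prime-step {ℓ} {a} {r} {t} {g} {h} ℓ-prime ℓ∤r ℓ∤t g-order h-order =
    subst (HasOrder _) (reassoc₃ ℓ (ℓ ℕ.^ a) r t) (HasOrder-* hʳ-order gᴸ-order ℓᵃ⁺¹⊥rt)
    where
    reassoc₁ : ∀ ℓ L r → ℓ ℕ.* (L ℕ.* r) ≡ r ℕ.* (ℓ ℕ.* L)
    reassoc₁ = ℕSolver.solve-∀
    reassoc₂ : ∀ t L r → t ℕ.* (L ℕ.* r) ≡ L ℕ.* (r ℕ.* t)
    reassoc₂ = ℕSolver.solve-∀
    reassoc₃ : ∀ ℓ L r t → ℓ ℕ.* L ℕ.* (r ℕ.* t) ≡ ℓ ℕ.* (t ℕ.* (L ℕ.* r))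
    reassoc₃ = ℕSolver.solve-∀
    hʳ-order : HasOrder (h ^ r) (ℓ ℕ.* ℓ ℕ.^ a)
    hʳ-order = HasOrder-^ r (subst (HasOrder h) (reassoc₁ ℓ (ℓ ℕ.^ a) r) h-order)
    gᴸ-order : HasOrder (g ^ (ℓ ℕ.^ a)) (r ℕ.* t)
    gᴸ-order = HasOrder-^ (ℓ ℕ.^ a) (subst (HasOrder g) (reassoc₂ t (ℓ ℕ.^ a) r) g-order)
    ℓ∤rt : ℓ ∤ r ℕ.* t
    ℓ∤rt ℓ∣rt with euclidsLemma r t ℓ-prime ℓ∣rt
    ... | inj₁ ℓ∣r = ℓ∤r ℓ∣r
    ... | inj₂ ℓ∣t = ℓ∤t ℓ∣t
    ℓᵃ⁺¹⊥rt : Coprime (ℓ ℕ.* ℓ ℕ.^ a) (r ℕ.* t)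
    ℓᵃ⁺¹⊥rt = prime∤⇒coprime-^ ℓ-prime ℓ∤rt (suc a)

  LargerOrderThan : ℕ → Set
  LargerOrderThan d = ∃₂ λ x e → HasOrder x e × d < e

  -- Write s = ℓ u with ℓ prime. If u ∤ d, recurse on h ^ ℓ, of order u. Otherwise d = t u
  -- with ℓ ∤ t, and HasOrder-prime-step yields an element of order ℓ d.
  ∤⇒larger-order : ∀ {g d h s} → HasOrder g d → HasOrder h s → s ∤ d → LargerOrderThan d
  ∤⇒larger-order {g} {d} g-order = <-rec (λ s → ∀ {h} → HasOrder h s → s ∤ d → LargerOrderThan d) larger _
    where
    instance _ = ℕ.>-nonZero (positive g-order)
    larger : ∀ s → (∀ {u} → u < s → ∀ {h} → HasOrder h u → u ∤ d → LargerOrderThan d) →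
             ∀ {h} → HasOrder h s → s ∤ d → LargerOrderThan d
    larger s rec {h} h-order s∤d with prime-factor (∤⇒1< (positive h-order) s∤d)
    ... | ℓ , u , ℓ-prime , refl with u ∣? d
    ...   | no  u∤d = rec u<ℓu (HasOrder-^ ℓ h-order) u∤d
      where
      instance _ = ℕ.>-nonZero (positive h-order)
               _ = ℕP.m*n≢0⇒n≢0 ℓ
      u<ℓu : u < ℓ ℕ.* u
      u<ℓu = subst (u <_) (ℕP.*-comm u ℓ) (ℕP.m<m*n u ℓ (ℕ.nonTrivial⇒n>1 ℓ {{prime⇒nonTrivial ℓ-prime}}))
    ...   | yes (divides t refl) with prime-power-split {u = u} ℓ-prime (ℕ.>-nonZero⁻¹ u {{ℕP.m*n≢0⇒n≢0 ℓ}})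
      where instance _ = ℕ.>-nonZero (positive h-order)
    ...     | a , r , refl , ℓ∤r =
      _ , _ , HasOrder-prime-step {a = a} ℓ-prime ℓ∤r ℓ∤t g-order h-order ,
      subst (d <_) (ℕP.*-comm d ℓ) (ℕP.m<m*n d ℓ (ℕ.nonTrivial⇒n>1 ℓ {{prime⇒nonTrivial ℓ-prime}}))
      where
      ℓ∤t : ℓ ∤ t
      ℓ∤t ℓ∣t = s∤d (*-monoˡ-∣ (ℓ ℕ.^ a ℕ.* r) ℓ∣t)

-- The lattice of the semi-cross

e-diagonal : ∀ {n} (j : Fin n) → e j j ≡ + 1
e-diagonal j with j ≟ j
... | yes _   = refl
... | no j≢j = contradiction refl j≢j

e-offDiagonal : ∀ {n} {i j : Fin n} → i ≢ j → e j i ≡ + 0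
e-offDiagonal {i = i} {j} i≢j with i ≟ j
... | yes i≡j = contradiction i≡j i≢j
... | no _    = refl

∑-δ : ∀ {n} (f : Fin n → ℤ) j → (∀ {i} → i ≢ j → f i ≡ 0ℤ) → ∑[ i < n ] f i ≡ f j
∑-δ {suc n} f j f≡0 = begin
  sum f                          ≡⟨ sum-remove {i = j} f ⟩
  f j + sum (f ∘ punchIn j)      ≡⟨ cong (_+_ (f j)) (sum-cong-≗ (λ i → f≡0 (FinP.punchInᵢ≢i j i))) ⟩
  f j + sum {n} (λ _ → 0ℤ)       ≡⟨ cong (_+_ (f j)) (sum-replicate-zero n) ⟩
  f j + 0ℤ                       ≡⟨ ℤP.+-identityʳ (f j) ⟩
  f j                            ∎
  where open ≡-Reasoning

module SemiCrossLattice {n : ℕ} (m : ℕ) (w : Fin n → ℤ) where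

  open Congruence m

  weight : Point n → ℤ
  weight x = ∑[ i < n ] (w i * x i)

  Lattice : Point n → Set
  Lattice x = weight x ≈ 0ℤ

  tileWeight : Maybe (Fin n) → ℤ
  tileWeight nothing  = 0ℤ
  tileWeight (just j) = w j

  weight-cong : ∀ {x y} → x ≋ y → weight x ≡ weight y
  weight-cong x≋y = sum-cong-≗ (λ i → cong (w i *_) (x≋y i))

  weight-⊕ : ∀ x y → weight (x ⊕ y) ≡ weight x + weight y
  weight-⊕ x y = trans (sum-cong-≗ (λ i → ℤP.*-distribˡ-+ (w i) (x i) (y i)))
                       (∑-distrib-+ (λ i → w i * x i) (λ i → w i * y i))

  weight-semiCross : ∀ v → weight (semiCross v) ≡ tileWeight v
  weight-semiCross nothing  = trans (sum-cong-≗ (λ i → ℤP.*-zeroʳ (w i))) (sum-replicate-zero n)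
  weight-semiCross (just j) = begin
    ∑[ i < n ] (w i * e j i)   ≡⟨ ∑-δ _ j (λ i≢j → trans (cong (w _ *_) (e-offDiagonal i≢j)) (ℤP.*-zeroʳ (w _))) ⟩
    w j * e j j                ≡⟨ cong (w j *_) (e-diagonal j) ⟩
    w j * + 1                  ≡⟨ ℤP.*-identityʳ (w j) ⟩
    w j                        ∎
    where open ≡-Reasoning

  weight-decomposition : ∀ {x} v {l} → x ≋ (semiCross v ⊕ l) → weight x ≡ tileWeight v + weight l
  weight-decomposition v {l} x≋v+l =
    trans (weight-cong x≋v+l) (trans (weight-⊕ (semiCross v) l) (cong (_+ weight l) (weight-semiCross v)))

  weight≈tileWeight : ∀ {x} v {l} → Lattice l → x ≋ (semiCross v ⊕ l) → weight x ≈ tileWeight v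
  weight≈tileWeight {x} v {l} l∈L x≋v+l = begin
    weight x                  ≡⟨ weight-decomposition v x≋v+l ⟩
    tileWeight v + weight l   ≈⟨ +-congˡ (tileWeight v) l∈L ⟩
    tileWeight v + 0ℤ         ≡⟨ ℤP.+-identityʳ (tileWeight v) ⟩
    tileWeight v              ∎
    where open ≈-Reasoning

  semiCross-tiles : Injective _≡_ _≈_ tileWeight → (∀ a → ∃ λ v → tileWeight v ≈ a) →
                    IsTiling semiCross Lattice
  semiCross-tiles tileWeight-injective tileWeight-complete x = decompose , unique
    where
    decompose : ∃ λ v → ∃ λ l → Lattice l × x ≋ (semiCross v ⊕ l)
    decompose with v , v≈x ← tileWeight-complete (weight x) = v , l , l∈L , x≋v+l
      where
      l : Point n
      l i = x i - semiCross v i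
      x≋v+l : x ≋ (semiCross v ⊕ l)
      x≋v+l i = split (x i) (semiCross v i)
        where split : ∀ a b → a ≡ b + (a - b)
              split = solve-∀
      l∈L : Lattice l
      l∈L = +-cancelˡ-≈ (tileWeight v) (begin
        tileWeight v + weight l   ≡⟨ weight-decomposition v x≋v+l ⟨
        weight x                  ≈⟨ v≈x ⟨
        tileWeight v              ≡⟨ ℤP.+-identityʳ (tileWeight v) ⟨
        tileWeight v + 0ℤ         ∎)
        where open ≈-Reasoning
    unique : ∀ v v′ l l′ → Lattice l → Lattice l′ → x ≋ (semiCross v ⊕ l) → x ≋ (semiCross v′ ⊕ l′) →
             v ≡ v′ × l ≋ l′
    unique v v′ l l′ l∈L l′∈L x≋v+l x≋v′+l′ = v≡v′ , l≋l′
      where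
      v≡v′ : v ≡ v′
      v≡v′ = tileWeight-injective (≈-trans (≈-sym (weight≈tileWeight v l∈L x≋v+l)) (weight≈tileWeight v′ l′∈L x≋v′+l′))
      l≋l′ : l ≋ l′
      l≋l′ i = +-cancelˡ (semiCross v i) (l i) (l′ i)
        (trans (sym (x≋v+l i)) (trans (x≋v′+l′ i) (cong (λ u → semiCross u i + l′ i) (sym v≡v′))))

shift-inject₁ : ∀ {n} (a : Point (suc n)) (i : Fin n) → shift a (inject₁ i) ≡ a (Fin.suc i)
shift-inject₁ {n} a i = cong a (FinP.toℕ-injective (begin
  toℕ (fromℕ< (m%n<n (suc (toℕ (inject₁ i))) (suc n)))  ≡⟨ FinP.toℕ-fromℕ< _ ⟩
  suc (toℕ (inject₁ i)) % suc n                         ≡⟨ cong (λ k → suc k % suc n) (FinP.toℕ-inject₁ i) ⟩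
  suc (toℕ i) % suc n                                   ≡⟨ m<n⇒m%n≡m (ℕ.s≤s (FinP.toℕ<n i)) ⟩
  suc (toℕ i)                                             ∎))
  where open ≡-Reasoning

shift-last : ∀ {n} (a : Point (suc n)) → shift a (fromℕ n) ≡ a Fin.zero
shift-last {n} a = cong a (FinP.toℕ-injective (begin
  toℕ (fromℕ< (m%n<n (suc (toℕ (fromℕ n))) (suc n)))  ≡⟨ FinP.toℕ-fromℕ< _ ⟩
  suc (toℕ (fromℕ n)) % suc n                         ≡⟨ cong (λ k → suc k % suc n) (FinP.toℕ-fromℕ n) ⟩
  suc n % suc n                                       ≡⟨ n%n≡0 (suc n) ⟩
  0                                                     ∎))
  where open ≡-Reasoning

module PowerLattice {n : ℕ} (m : ℕ) (g : ℤ) where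

  open Congruence m
  open SemiCrossLattice m (λ (i : Fin (suc n)) → g ^ toℕ i) public

  g*weight-shift : g ^ suc n ≈ 1ℤ → ∀ a → g * weight (shift a) ≈ weight a
  g*weight-shift gⁿ⁺¹≈1 a = begin
    g * weight (shift a)                                          ≡⟨ *-distribˡ-sum g (λ i → g ^ toℕ i * shift a i) ⟩
    ∑[ i < suc n ] (g * (g ^ toℕ i * shift a i))                  ≡⟨ sum-init-last (λ i → g * (g ^ toℕ i * shift a i)) ⟩
    ∑[ i < n ] (g * (g ^ toℕ (inject₁ i) * shift a (inject₁ i)))
      + g * (g ^ toℕ (fromℕ n) * shift a (fromℕ n))               ≡⟨ cong₂ _+_ (sum-cong-≗ inner) outer ⟩
    tail + g ^ suc n * a Fin.zero                                 ≈⟨ +-congˡ tail (*-congʳ (a Fin.zero) gⁿ⁺¹≈1) ⟩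
    tail + 1ℤ * a Fin.zero                                        ≡⟨ ℤP.+-comm tail (1ℤ * a Fin.zero) ⟩
    weight a                                                      ∎
    where
    open ≈-Reasoning
    tail : ℤ
    tail = ∑[ i < n ] (g ^ suc (toℕ i) * a (Fin.suc i))
    inner : ∀ i → g * (g ^ toℕ (inject₁ i) * shift a (inject₁ i)) ≡ g ^ suc (toℕ i) * a (Fin.suc i)
    inner i = trans (cong₂ (λ k x → g * (g ^ k * x)) (FinP.toℕ-inject₁ i) (shift-inject₁ a i))
                    (sym (ℤP.*-assoc g (g ^ toℕ i) (a (Fin.suc i))))
    outer : g * (g ^ toℕ (fromℕ n) * shift a (fromℕ n)) ≡ g ^ suc n * a Fin.zero
    outer = trans (cong₂ (λ k x → g * (g ^ k * x)) (FinP.toℕ-fromℕ n) (shift-last a))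
                  (sym (ℤP.*-assoc g (g ^ n) (a Fin.zero)))

  Lattice-shift : g ^ suc n ≈ 1ℤ → ∀ a → Lattice a → Lattice (shift a)
  Lattice-shift gⁿ⁺¹≈1 a a∈L = begin
    weight (shift a)                  ≡⟨ ℤP.*-identityˡ _ ⟨
    1ℤ * weight (shift a)             ≈⟨ *-congʳ (weight (shift a)) gⁿ⁺¹≈1 ⟨
    g ^ suc n * weight (shift a)      ≡⟨ reassoc g (g ^ n) (weight (shift a)) ⟩
    g ^ n * (g * weight (shift a))    ≈⟨ *-congˡ (g ^ n) (g*weight-shift gⁿ⁺¹≈1 a) ⟩
    g ^ n * weight a                  ≈⟨ *-congˡ (g ^ n) a∈L ⟩
    g ^ n * 0ℤ                        ≡⟨ ℤP.*-zeroʳ (g ^ n) ⟩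
    0ℤ                                ∎
    where
    open ≈-Reasoning
    reassoc : ∀ g x w → g * x * w ≡ x * (g * w)
    reassoc = solve-∀

  Lattice-cyclic : g ^ suc n ≈ 1ℤ → CyclicallyClosed Lattice
  Lattice-cyclic gⁿ⁺¹≈1 zero    a a∈L = a∈L
  Lattice-cyclic gⁿ⁺¹≈1 (suc k) a a∈L = Lattice-shift gⁿ⁺¹≈1 (shiftIter k a) (Lattice-cyclic gⁿ⁺¹≈1 k a a∈L)

-- Polynomials, with coefficients listed from the constant term up

eval : ∀ {d} → Vec ℤ d → ℤ → ℤ
eval []       x = 0ℤ
eval (c ∷ cs) x = c + x * eval cs x

-- deflate cs a is the quotient of cs by x - a.
deflate : ∀ {d} → Vec ℤ (suc d) → ℤ → Vec ℤ d
deflate {zero}  (c ∷ []) a = []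
deflate {suc d} (c ∷ cs) a = eval cs a ∷ deflate cs a

eval-deflate : ∀ {d} (cs : Vec ℤ (suc d)) x a → eval cs x - eval cs a ≡ (x - a) * eval (deflate cs a) x
eval-deflate {zero}  (c ∷ []) x a = constant c x a
  where constant : ∀ c x a → c + x * 0ℤ - (c + a * 0ℤ) ≡ (x - a) * 0ℤ
        constant = solve-∀
eval-deflate {suc d} (c ∷ cs) x a = begin
  c + x * eval cs x - (c + a * eval cs a)              ≡⟨ horner c x a (eval cs x) (eval cs a) ⟩
  x * (eval cs x - eval cs a) + (x - a) * eval cs a    ≡⟨ cong (λ y → x * y + (x - a) * eval cs a) (eval-deflate cs x a) ⟩
  x * ((x - a) * q) + (x - a) * eval cs a              ≡⟨ factor x a (eval cs a) q ⟩
  (x - a) * (eval cs a + x * q)                        ∎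
  where
  open ≡-Reasoning
  q = eval (deflate cs a) x
  horner : ∀ c x a E A → c + x * E - (c + a * A) ≡ x * (E - A) + (x - a) * A
  horner = solve-∀
  factor : ∀ x a A Q → x * ((x - a) * Q) + (x - a) * A ≡ (x - a) * (A + x * Q)
  factor = solve-∀

last-deflate : ∀ {d} (cs : Vec ℤ (suc (suc d))) a → last (deflate cs a) ≡ last cs
last-deflate {zero}  (c ∷ c′ ∷ []) a = trans (cong (_+_ c′) (ℤP.*-zeroʳ a)) (ℤP.+-identityʳ c′)
last-deflate {suc d} (c ∷ cs)      a = last-deflate cs a

monomial : ∀ d → Vec ℤ (suc d)
monomial zero    = 1ℤ ∷ []
monomial (suc d) = 0ℤ ∷ monomial d

eval-monomial : ∀ d x → eval (monomial d) x ≡ x ^ d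
eval-monomial zero    x = cong (_+_ 1ℤ) (ℤP.*-zeroʳ x)
eval-monomial (suc d) x = trans (ℤP.+-identityˡ _) (cong (x *_) (eval-monomial d x))

last-monomial : ∀ d → last (monomial d) ≡ 1ℤ
last-monomial zero    = refl
last-monomial (suc d) = last-monomial d

toMaybe : ∀ {n} → Fin (suc n) → Maybe (Fin n)
toMaybe Fin.zero    = nothing
toMaybe (Fin.suc i) = just i

toMaybe-injective : ∀ {n} → Injective _≡_ _≡_ (toMaybe {n})
toMaybe-injective {x = Fin.zero}  {Fin.zero}  _    = refl
toMaybe-injective {x = Fin.suc i} {Fin.suc j} refl = refl

-- Prime moduli

module PrimeModulus {p′ : ℕ} (p-prime : Prime (suc p′)) where

  open Congruence (suc p′)
  open Residues p′
  open Order (suc p′)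

  *≈0⇒≈0⊎≈0 : ∀ a b → a * b ≈ 0ℤ → a ≈ 0ℤ ⊎ b ≈ 0ℤ
  *≈0⇒≈0⊎≈0 a b ab≈0 with euclidsLemma ∣ a ∣ ∣ b ∣ p-prime (subst (suc p′ ∣_) (ℤP.abs-* a b) (≈0⇒∣∣∣ ab≈0))
  ... | inj₁ p∣a = inj₁ (∣∣∣⇒≈0 p∣a)
  ... | inj₂ p∣b = inj₂ (∣∣∣⇒≈0 p∣b)

  +[1+i]≉0 : ∀ {i} → i < p′ → + suc i ≉ 0ℤ
  +[1+i]≉0 i<p′ 1+i≈0 = ℕP.1+n≢0 (+≈+⇒≡ (ℕ.s≤s i<p′) ℕ.z<s 1+i≈0)

  1≉0 : 1ℤ ≉ 0ℤ
  1≉0 = +[1+i]≉0 (ℕ.s≤s⁻¹ (ℕ.nonTrivial⇒n>1 (suc p′) {{prime⇒nonTrivial p-prime}}))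

  *-cancelˡ-≈ : ∀ c {a b} → c ≉ 0ℤ → c * a ≈ c * b → a ≈ b
  *-cancelˡ-≈ c {a} {b} c≉0 ca≈cb with *≈0⇒≈0⊎≈0 c (a - b) (subst (_≈ 0ℤ) (factor c a b) (≈⇒-≈0 ca≈cb))
    where factor : ∀ c a b → c * a - c * b ≡ c * (a - b)
          factor = solve-∀
  ... | inj₁ c≈0   = contradiction c≈0 c≉0
  ... | inj₂ a-b≈0 = -≈0⇒≈ a-b≈0

  ^≉0 : ∀ {a} → a ≉ 0ℤ → ∀ k → a ^ k ≉ 0ℤ
  ^≉0 a≉0 zero            = 1≉0
  ^≉0 {a} a≉0 (suc k) aᵏ⁺¹≈0 with *≈0⇒≈0⊎≈0 a (a ^ k) aᵏ⁺¹≈0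
  ... | inj₁ a≈0  = a≉0 a≈0
  ... | inj₂ aᵏ≈0 = ^≉0 a≉0 k aᵏ≈0

  ^≈^⇒^∸≈1 : ∀ {a i j} → a ≉ 0ℤ → i ≤ j → a ^ i ≈ a ^ j → a ^ (j ∸ i) ≈ 1ℤ
  ^≈^⇒^∸≈1 {a} {i} {j} a≉0 i≤j aⁱ≈aʲ = ≈-sym (*-cancelˡ-≈ (a ^ i) (^≉0 a≉0 i) (begin
    a ^ i * 1ℤ            ≡⟨ ℤP.*-identityʳ (a ^ i) ⟩
    a ^ i                 ≈⟨ aⁱ≈aʲ ⟩
    a ^ j                 ≡⟨ cong (a ^_) (ℕP.m+[n∸m]≡n i≤j) ⟨
    a ^ (i ℕ.+ (j ∸ i))   ≡⟨ ℤP.^-distribˡ-+-* a i (j ∸ i) ⟩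
    a ^ i * a ^ (j ∸ i)   ∎))
    where open ≈-Reasoning

  HasOrder⇒≉0 : ∀ {a d} → HasOrder a d → a ≉ 0ℤ
  HasOrder⇒≉0 {a} {suc d} a-order a≈0 = 1≉0 (begin
    1ℤ              ≈⟨ ^d≈1 a-order ⟨
    a * a ^ d       ≈⟨ *-congʳ (a ^ d) a≈0 ⟩
    0ℤ * a ^ d      ≡⟨ ℤP.*-zeroˡ (a ^ d) ⟩
    0ℤ              ∎)
    where open ≈-Reasoning

  HasOrder-exists : ∀ {a} → a ≉ 0ℤ → ∃ λ d → d ≤ p′ × HasOrder a d
  HasOrder-exists {a} a≉0 = fromCollision (nonzero-collision (λ i → a ^ toℕ i) (λ i → ^≉0 a≉0 (toℕ i)))
    where
    P : ℕ → Set
    P k = 0 < k × a ^ k ≈ 1ℤ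
    fromPeriod : ∀ e → e ≤ p′ → P e → ∃ λ d → d ≤ p′ × HasOrder a d
    fromPeriod e e≤p′ Pe =
      let d , d≤e , (0<d , aᵈ≈1) , below = leastWitness (λ k → (0 ℕ.<? k) ×-dec (a ^ k ≈? 1ℤ)) e Pe
      in d , ℕP.≤-trans d≤e e≤p′ , least⇒HasOrder 0<d aᵈ≈1 (λ 0<j j<d aʲ≈1 → below j<d (0<j , aʲ≈1))
    fromCollision : (∃ λ i → ∃ λ j → i Fin.< j × a ^ toℕ i ≈ a ^ toℕ j) → ∃ λ d → d ≤ p′ × HasOrder a d
    fromCollision (i , j , i<j , aⁱ≈aʲ) = fromPeriod (toℕ j ∸ toℕ i)
      (ℕP.≤-trans (ℕP.m∸n≤m (toℕ j) (toℕ i)) (ℕ.s≤s⁻¹ (FinP.toℕ<n j)))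
      (ℕP.m<n⇒0<n∸m i<j , ^≈^⇒^∸≈1 a≉0 (ℕP.<⇒≤ i<j) aⁱ≈aʲ)

  HasOrder⇒≤ : ∀ {a d} → HasOrder a d → d ≤ p′
  HasOrder⇒≤ a-order =
    let e , e≤p′ , a-order′ = HasOrder-exists (HasOrder⇒≉0 a-order)
    in subst (_≤ p′) (HasOrder-unique a-order′ a-order) e≤p′

  HasOrder⇒^-injective : ∀ {g d i j} → HasOrder g d → i ≤ j → j < d → g ^ i ≈ g ^ j → i ≡ j
  HasOrder⇒^-injective {i = i} {j} g-order i≤j j<d gⁱ≈gʲ = ℕP.≤-antisym i≤j (ℕP.m∸n≡0⇒m≤n j∸i≡0)
    where
    j∸i≡0 : j ∸ i ≡ 0
    j∸i≡0 = ∣∧<⇒≡0 (^≈1⇒∣ g-order (^≈^⇒^∸≈1 (HasOrder⇒≉0 g-order) i≤j gⁱ≈gʲ))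
                   (ℕP.≤-<-trans (ℕP.m∸n≤m j i) j<d)

  lagrange : ∀ {d} (cs : Vec ℤ (suc d)) (r : Fin (suc d) → ℤ) → Injective _≡_ _≈_ r →
             (∀ i → eval cs (r i) ≈ 0ℤ) → last cs ≈ 0ℤ
  lagrange {zero}  (c ∷ []) r _ roots = ≈-trans (≡⇒≈ (sym constant)) (roots Fin.zero)
    where constant : c + r Fin.zero * 0ℤ ≡ c
          constant = trans (cong (_+_ c) (ℤP.*-zeroʳ (r Fin.zero))) (ℤP.+-identityʳ c)
  lagrange {suc d} cs r r-injective roots =
    subst (_≈ 0ℤ) (last-deflate cs r₀) (lagrange (deflate cs r₀) (r ∘ Fin.suc) (FinP.suc-injective ∘ r-injective) roots′)
    where
    r₀ = r Fin.zero
    roots′ : ∀ i → eval (deflate cs r₀) (r (Fin.suc i)) ≈ 0ℤ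
    roots′ i with *≈0⇒≈0⊎≈0 (r (Fin.suc i) - r₀) (eval (deflate cs r₀) (r (Fin.suc i)))
                   (subst (_≈ 0ℤ) (eval-deflate cs (r (Fin.suc i)) r₀) (+-cong (roots (Fin.suc i)) (-‿cong (roots Fin.zero))))
    ... | inj₁ rᵢ-r₀≈0 = contradiction (r-injective (-≈0⇒≈ rᵢ-r₀≈0)) λ ()
    ... | inj₂ q≈0     = q≈0

  ^≈1-solutions : ∀ {k d} → 0 < d → (r : Fin k → ℤ) → Injective _≡_ _≈_ r → (∀ i → r i ^ d ≈ 1ℤ) → k ≤ d
  ^≈1-solutions {k} {suc d} _ r r-injective rᵈ≈1 = ℕP.≮⇒≥ λ d<k →
    1≉0 (subst (_≈ 0ℤ) (last-monomial d)
      (lagrange (-1ℤ ∷ monomial d) (λ i → r (inject≤ i d<k))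
        (λ eq → FinP.inject≤-injective d<k d<k _ _ (r-injective eq))
        (λ i → root (r (inject≤ i d<k)) (rᵈ≈1 (inject≤ i d<k)))))
    where
    root : ∀ x → x ^ suc d ≈ 1ℤ → eval (-1ℤ ∷ monomial d) x ≈ 0ℤ
    root x xᵈ≈1 = begin
      -1ℤ + x * eval (monomial d) x     ≡⟨ cong (λ y → -1ℤ + x * y) (eval-monomial d x) ⟩
      -1ℤ + x ^ suc d                   ≈⟨ +-congˡ -1ℤ xᵈ≈1 ⟩
      -1ℤ + 1ℤ                          ≡⟨⟩
      0ℤ                                ∎
      where open ≈-Reasoning

  unit : Fin p′ → ℤ
  unit i = + suc (toℕ i)

  unit≉0 : ∀ i → unit i ≉ 0ℤ
  unit≉0 i = +[1+i]≉0 (FinP.toℕ<n i)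

  unit-injective : Injective _≡_ _≈_ unit
  unit-injective {i} {j} uᵢ≈uⱼ =
    FinP.toℕ-injective (ℕP.suc-injective (+≈+⇒≡ (ℕ.s≤s (FinP.toℕ<n i)) (ℕ.s≤s (FinP.toℕ<n j)) uᵢ≈uⱼ))

  primitiveRoot : ∃ λ g → HasOrder g p′
  primitiveRoot = raise p′ HasOrder-1 (ℕP.m≤n+m p′ 1)
    where
    raise : ∀ k {g d} → HasOrder g d → p′ ≤ d ℕ.+ k → ∃ λ g → HasOrder g p′
    raise zero {g} {d} g-order p′≤d+0 =
      g , subst (HasOrder g) (ℕP.≤-antisym (HasOrder⇒≤ g-order) (subst (p′ ≤_) (ℕP.+-identityʳ d) p′≤d+0)) g-order
    raise (suc k) {g} {d} g-order p′≤d+k+1 with FinP.all? (λ i → unit i ^ d ≈? 1ℤ)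
    ... | yes unitsᵈ≈1 =
      g , subst (HasOrder g) (ℕP.≤-antisym (HasOrder⇒≤ g-order) (^≈1-solutions (positive g-order) unit unit-injective unitsᵈ≈1)) g-order
    ... | no ¬unitsᵈ≈1 =
      let i , uᵢᵈ≉1 = FinP.¬∀⟶∃¬ p′ _ (λ i → unit i ^ d ≈? 1ℤ) ¬unitsᵈ≈1
          s , _ , uᵢ-order = HasOrder-exists (unit≉0 i)
          x , e , x-order , d<e = ∤⇒larger-order g-order uᵢ-order (uᵢᵈ≉1 ∘ ∣⇒^≈1 uᵢ-order)
      in raise k x-order (ℕP.≤-trans p′≤d+k+1 (ℕP.≤-trans (ℕP.≤-reflexive (ℕP.+-suc d k)) (ℕP.+-monoˡ-≤ k d<e)))

  module _ {g : ℤ} (g-order : HasOrder g p′) where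

    open SemiCrossLattice (suc p′) (λ (i : Fin p′) → g ^ toℕ i)

    tileWeight-injective : Injective _≡_ _≈_ tileWeight
    tileWeight-injective {nothing} {nothing} _     = refl
    tileWeight-injective {nothing} {just j}  0≈gʲ = contradiction (≈-sym 0≈gʲ) (^≉0 (HasOrder⇒≉0 g-order) (toℕ j))
    tileWeight-injective {just i}  {nothing} gⁱ≈0 = contradiction gⁱ≈0 (^≉0 (HasOrder⇒≉0 g-order) (toℕ i))
    tileWeight-injective {just i}  {just j}  gⁱ≈gʲ with ℕP.≤-total (toℕ i) (toℕ j)
    ... | inj₁ i≤j = cong just (FinP.toℕ-injective (HasOrder⇒^-injective g-order i≤j (FinP.toℕ<n j) gⁱ≈gʲ))
    ... | inj₂ j≤i = cong just (FinP.toℕ-injective (sym (HasOrder⇒^-injective g-order j≤i (FinP.toℕ<n i) (≈-sym gⁱ≈gʲ))))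

    tileWeight-complete : ∀ a → ∃ λ v → tileWeight v ≈ a
    tileWeight-complete a =
      let i , wᵢ≈a = injective⇒complete (tileWeight ∘ toMaybe) (toMaybe-injective ∘ tileWeight-injective) a
      in toMaybe i , wᵢ≈a

mainTheorem18 : (q : ℕ) → Prime q → q > 2 →
    Σ (Point (q ∸ 1) → Set) (λ L → IsTiling semiCross L × CyclicallyClosed L)
mainTheorem18 q@(suc (suc n)) q-prime _ =
  Lattice , semiCross-tiles (tileWeight-injective g-order) (tileWeight-complete g-order) , Lattice-cyclic (^d≈1 g-order)
  where
  open PrimeModulus q-prime
  open Order q
  g : ℤ
  g = proj₁ primitiveRoot
  g-order : HasOrder g (suc n)
  g-order = proj₂ primitiveRoot
  open PowerLattice {n} q g
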